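{- Let $k$ be an odd positive integer and let $F_k:\mathbb{N}\to\mathbb{N}$ be given by $F_k(n)=\frac{3n+k}{2}$ if $n$ is odd and $F_k(n)=\frac{n}{2}$ if $n$ is even. Let $C$ be a cycle of $F_k$ with minimal element $T_0$, and let $(u_1,d_1,\dots,u_s,d_s)$ be the orb sequence of the cycle read starting from $T_0$, i.e. positive integers such that iterating $F_k$ from $T_0$ one first meets $u_1$ odd values, then $d_1$ even values, then $u_2$ odd values, etc., ending with $d_s$ even values, after which one returns to $T_0$ for the first time. Then $$T_0=\frac{k\alpha}{\beta},$$ where $U=\sum_{i=1}^s u_i$, $D=\sum_{i=1}^s d_i$, $\beta=2^{U+D}-3^{U}$ and $$\alpha=\sum_{i=1}^{s} 2^{\sum_{j=1}^{i-1}(u_j+d_j)}\,(3^{u_i}-2^{u_i})\,3^{\sum_{j=i+1}^{s}u_j}$$ (empty sums are $0$).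
   Context: A cycle of $F_k$ is a set $\{x,F_k(x),\dots,F_k^{p-1}(x)\}$ with $x\in\mathbb{N}$, $p\ge1$, $F_k^p(x)=x$. (The minimal element of a cycle is necessarily odd, so the orb sequence starting at $T_0$ begins with an odd block.) -}

module Defs where

open import Data.Nat using (ℕ; zero; suc; _+_; _*_; _∸_; _^_; _%_; _/_; _≡ᵇ_)
open import Data.Bool using (Bool; true; false; if_then_else_)
open import Data.Nat.ListAction using (sum)
open import Data.List using (List; map; upTo; concatMap; replicate; _++_)
open import Function using (_∘_)

isOdd : ℕ → Bool
isOdd n = (n % 2) ≡ᵇ 1

F : ℕ → ℕ → ℕ
F k n = if isOdd n then (3 * n + k) / 2 else n / 2

iter : ℕ → ℕ → ℕ → ℕ
iter k zero    n = n
iter k (suc m) n = F k (iter k m n)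

-- the list [a, a+1, ..., b]  (empty if b < a)
range : ℕ → ℕ → List ℕ
range a b = map (a +_) (upTo (suc b ∸ a))

Σ[_from_to_] : (ℕ → ℕ) → ℕ → ℕ → ℕ
Σ[ f from a to b ] = sum (map f (range a b))

-- parity word of an orb sequence (u_1,d_1,...,u_s,d_s):
-- u_1 times 'odd' (true), d_1 times 'even' (false), ..., d_s times 'even'
orbWord : ℕ → (ℕ → ℕ) → (ℕ → ℕ) → List Bool
orbWord s u d = concatMap (λ i → replicate (u i) true ++ replicate (d i) false) (range 1 s)

parityWord : ℕ → ℕ → ℕ → List Bool
parityWord k p T = map (λ m → isOdd (iter k m T)) (upTo p)

-- A parity word w of length n determines F_k^n on every starting value with that
-- itinerary as an affine map: 2^n F_k^n(T) = 3^(#odd steps of w) T + k c(w), where c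
-- obeys c(v ++ w) = c(v) 3^(#odd w) + 2^|v| c(w) and c(1^u 0^d) = 3^u - 2^u.  For the
-- orb word of the cycle this makes c equal to α, and F_k^(U+D)(T₀) = T₀ turns the
-- affine identity into T₀ (2^(U+D) - 3^U) = k α.
module Submission where

open import Defs
open import Data.Nat using (ℕ; zero; suc; _+_; _*_; _∸_; _^_; _%_; _/_; _≡ᵇ_; _≤_; _<_; s≤s; z≤n)
open import Data.Nat.Properties
open import Data.Nat.DivMod using (m≡m%n+[m/n]*n; m%n<n; m*n/n≡m; m*n%n≡0; [m+kn]%n≡m%n)
open import Data.Nat.ListAction using (sum)
open import Data.Nat.ListAction.Properties using (sum-++)
open import Data.Nat.Tactic.RingSolver using (solve-∀)
open import Data.Bool using (Bool; true; false; if_then_else_)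
open import Function using (_∘_)
open import Data.List using (List; []; _∷_; map; upTo; applyUpTo; concatMap; replicate; _++_; length; [_])
open import Data.List.Properties
  using (map-∘; map-cong; upTo-∷ʳ; map-++; concatMap-++; ++-identityʳ; map-upTo; length-++; length-replicate)
open import Relation.Binary.PropositionalEquality hiding ([_])
open import Data.Integer as ℤ using (ℤ; +_; _-_)
import Data.Integer.Properties as ℤ
import Data.Integer.Tactic.RingSolver as ℤ-Solver

open ≡-Reasoning

data Parity : ℕ → Set where
  even : ∀ h → Parity (h * 2)
  odd  : ∀ h → Parity (1 + h * 2)

parity : ∀ n → Parity n
parity n with n % 2 | m%n<n n 2 | m≡m%n+[m/n]*n n 2
... | 0           | _             | n≡ = subst Parity (sym n≡) (even (n / 2))
... | 1           | _             | n≡ = subst Parity (sym n≡) (odd (n / 2))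
... | suc (suc _) | s≤s (s≤s ()) | _

isOdd-even : ∀ h → isOdd (h * 2) ≡ false
isOdd-even h = cong (_≡ᵇ 1) (m*n%n≡0 h 2)

isOdd-odd : ∀ h → isOdd (1 + h * 2) ≡ true
isOdd-odd h = cong (_≡ᵇ 1) ([m+kn]%n≡m%n 1 h 2)

2*F≡ : ∀ {k} → k % 2 ≡ 1 → ∀ n → 2 * F k n ≡ (if isOdd n then 3 * n + k else n)
2*F≡ {k} k-odd n with parity n | parity k
... | even h | _ rewrite isOdd-even h = trans (cong (2 *_) (m*n/n≡m h 2)) (*-comm 2 h)
... | odd h  | even j with trans (sym (m*n%n≡0 j 2)) k-odd
...   | ()
2*F≡ _ _ | odd h | odd j rewrite isOdd-odd h = begin
    2 * ((3 * (1 + h * 2) + (1 + j * 2)) / 2)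
  ≡⟨ cong (λ m → 2 * (m / 2)) (halved h j) ⟩
    2 * ((3 * h + j + 2) * 2 / 2)
  ≡⟨ cong (2 *_) (m*n/n≡m (3 * h + j + 2) 2) ⟩
    2 * (3 * h + j + 2)
  ≡⟨ *-comm 2 (3 * h + j + 2) ⟩
    (3 * h + j + 2) * 2
  ≡⟨ halved h j ⟨
    3 * (1 + h * 2) + (1 + j * 2)
  ∎
  where
  halved : ∀ h j → 3 * (1 + h * 2) + (1 + j * 2) ≡ (3 * h + j + 2) * 2
  halved = solve-∀

iter-sucʳ : ∀ k m T → iter k (suc m) T ≡ iter k m (F k T)
iter-sucʳ k zero    T = refl
iter-sucʳ k (suc m) T = cong (F k) (iter-sucʳ k m T)

parityWord-suc : ∀ k n T → parityWord k (suc n) T ≡ isOdd T ∷ parityWord k n (F k T)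
parityWord-suc k n T = cong (isOdd T ∷_) (begin
    map parity-at (applyUpTo suc n)
  ≡⟨ cong (map parity-at) (map-upTo suc n) ⟨
    map parity-at (map suc (upTo n))
  ≡⟨ map-∘ (upTo n) ⟨
    map (parity-at ∘ suc) (upTo n)
  ≡⟨ map-cong (λ m → cong isOdd (iter-sucʳ k m T)) (upTo n) ⟩
    parityWord k n (F k T)
  ∎)
  where
  parity-at : ℕ → Bool
  parity-at m = isOdd (iter k m T)

oddSteps : List Bool → ℕ
oddSteps []          = 0
oddSteps (true ∷ w)  = suc (oddSteps w)
oddSteps (false ∷ w) = oddSteps w

-- The constant c(w) of the affine law 2^|w| F_k^|w|(T) = 3^(oddSteps w) T + k c(w)
-- for starting values T with itinerary w.
offset : List Bool → ℕ
offset []          = 0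
offset (true ∷ w)  = 3 ^ oddSteps w + 2 * offset w
offset (false ∷ w) = 2 * offset w

affine-∷ : ∀ b {k T y} w → 2 * y ≡ (if b then 3 * T + k else T) →
  2 * (3 ^ oddSteps w * y + k * offset w) ≡ 3 ^ oddSteps (b ∷ w) * T + k * offset (b ∷ w)
affine-∷ true {k} {T} {y} w 2y≡ = begin
    2 * (3 ^ oddSteps w * y + k * offset w)
  ≡⟨ distrib (3 ^ oddSteps w) y k (offset w) ⟩
    3 ^ oddSteps w * (2 * y) + 2 * (k * offset w)
  ≡⟨ cong (λ z → 3 ^ oddSteps w * z + 2 * (k * offset w)) 2y≡ ⟩
    3 ^ oddSteps w * (3 * T + k) + 2 * (k * offset w)
  ≡⟨ regroup (3 ^ oddSteps w) T k (offset w) ⟩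
    3 * 3 ^ oddSteps w * T + k * (3 ^ oddSteps w + 2 * offset w)
  ∎
  where
  distrib : ∀ x y k c → 2 * (x * y + k * c) ≡ x * (2 * y) + 2 * (k * c)
  distrib = solve-∀
  regroup : ∀ x T k c → x * (3 * T + k) + 2 * (k * c) ≡ 3 * x * T + k * (x + 2 * c)
  regroup = solve-∀
affine-∷ false {k} {T} {y} w 2y≡ = begin
    2 * (3 ^ oddSteps w * y + k * offset w)
  ≡⟨ distrib (3 ^ oddSteps w) y k (offset w) ⟩
    3 ^ oddSteps w * (2 * y) + k * (2 * offset w)
  ≡⟨ cong (λ z → 3 ^ oddSteps w * z + k * (2 * offset w)) 2y≡ ⟩
    3 ^ oddSteps w * T + k * (2 * offset w)
  ∎
  where
  distrib : ∀ x y k c → 2 * (x * y + k * c) ≡ x * (2 * y) + k * (2 * c)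
  distrib = solve-∀

iter-affine : ∀ {k} → k % 2 ≡ 1 → ∀ n T →
  2 ^ n * iter k n T ≡ 3 ^ oddSteps (parityWord k n T) * T + k * offset (parityWord k n T)
iter-affine {k} k-odd zero T = begin
    1 * T            ≡⟨ +-identityʳ (1 * T) ⟨
    1 * T + 0        ≡⟨ cong (_+_ (1 * T)) (*-zeroʳ k) ⟨
    1 * T + k * 0    ∎
iter-affine {k} k-odd (suc n) T = begin
    2 ^ suc n * iter k (suc n) T
  ≡⟨ cong (2 ^ suc n *_) (iter-sucʳ k n T) ⟩
    2 * 2 ^ n * iter k n (F k T)
  ≡⟨ *-assoc 2 (2 ^ n) _ ⟩
    2 * (2 ^ n * iter k n (F k T))
  ≡⟨ cong (2 *_) (iter-affine k-odd n (F k T)) ⟩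
    2 * (3 ^ oddSteps w * F k T + k * offset w)
  ≡⟨ affine-∷ (isOdd T) w (2*F≡ k-odd T) ⟩
    3 ^ oddSteps (isOdd T ∷ w) * T + k * offset (isOdd T ∷ w)
  ≡⟨ cong (λ v → 3 ^ oddSteps v * T + k * offset v) (parityWord-suc k n T) ⟨
    3 ^ oddSteps (parityWord k (suc n) T) * T + k * offset (parityWord k (suc n) T)
  ∎
  where
  w = parityWord k n (F k T)

oddSteps-++ : ∀ v w → oddSteps (v ++ w) ≡ oddSteps v + oddSteps w
oddSteps-++ []          w = refl
oddSteps-++ (true ∷ v)  w = cong suc (oddSteps-++ v w)
oddSteps-++ (false ∷ v) w = oddSteps-++ v w

offset-++ : ∀ v w → offset (v ++ w) ≡ offset v * 3 ^ oddSteps w + 2 ^ length v * offset w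
offset-++ []          w = sym (+-identityʳ (offset w))
offset-++ (true ∷ v)  w = begin
    3 ^ oddSteps (v ++ w) + 2 * offset (v ++ w)
  ≡⟨ cong₂ (λ p c → p + 2 * c) 3^oddSteps-++ (offset-++ v w) ⟩
    3 ^ oddSteps v * 3 ^ oddSteps w + 2 * (offset v * 3 ^ oddSteps w + 2 ^ length v * offset w)
  ≡⟨ regroup (3 ^ oddSteps v) (3 ^ oddSteps w) (offset v) (2 ^ length v) (offset w) ⟩
    (3 ^ oddSteps v + 2 * offset v) * 3 ^ oddSteps w + 2 * 2 ^ length v * offset w
  ∎
  where
  3^oddSteps-++ : 3 ^ oddSteps (v ++ w) ≡ 3 ^ oddSteps v * 3 ^ oddSteps w
  3^oddSteps-++ = trans (cong (3 ^_) (oddSteps-++ v w)) (^-distribˡ-+-* 3 (oddSteps v) (oddSteps w))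
  regroup : ∀ x y c p e → x * y + 2 * (c * y + p * e) ≡ (x + 2 * c) * y + 2 * p * e
  regroup = solve-∀
offset-++ (false ∷ v) w = begin
    2 * offset (v ++ w)
  ≡⟨ cong (2 *_) (offset-++ v w) ⟩
    2 * (offset v * 3 ^ oddSteps w + 2 ^ length v * offset w)
  ≡⟨ regroup (offset v) (3 ^ oddSteps w) (2 ^ length v) (offset w) ⟩
    2 * offset v * 3 ^ oddSteps w + 2 * 2 ^ length v * offset w
  ∎
  where
  regroup : ∀ c y p e → 2 * (c * y + p * e) ≡ 2 * c * y + 2 * p * e
  regroup = solve-∀

block : ℕ → ℕ → List Bool
block a b = replicate a true ++ replicate b false

oddSteps-block : ∀ a b → oddSteps (block a b) ≡ a
oddSteps-block zero    zero    = refl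
oddSteps-block zero    (suc b) = oddSteps-block zero b
oddSteps-block (suc a) b       = cong suc (oddSteps-block a b)

length-block : ∀ a b → length (block a b) ≡ a + b
length-block a b = begin
    length (replicate a true ++ replicate b false)
  ≡⟨ length-++ (replicate a true) ⟩
    length (replicate a true) + length (replicate b false)
  ≡⟨ cong₂ _+_ (length-replicate a) (length-replicate b) ⟩
    a + b
  ∎

offset-block+2^ : ∀ a b → offset (block a b) + 2 ^ a ≡ 3 ^ a
offset-block+2^ zero    b = cong (_+ 1) (offset-falses b)
  where
  offset-falses : ∀ b → offset (replicate b false) ≡ 0
  offset-falses zero    = refl
  offset-falses (suc b) = cong (2 *_) (offset-falses b)
offset-block+2^ (suc a) b = begin
    3 ^ oddSteps (block a b) + 2 * offset (block a b) + 2 * 2 ^ a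
  ≡⟨ cong (λ e → 3 ^ e + 2 * offset (block a b) + 2 * 2 ^ a) (oddSteps-block a b) ⟩
    3 ^ a + 2 * offset (block a b) + 2 * 2 ^ a
  ≡⟨ regroup (3 ^ a) (offset (block a b)) (2 ^ a) ⟩
    3 ^ a + 2 * (offset (block a b) + 2 ^ a)
  ≡⟨ cong (λ z → 3 ^ a + 2 * z) (offset-block+2^ a b) ⟩
    3 ^ a + 2 * 3 ^ a
  ≡⟨ triple (3 ^ a) ⟩
    3 * 3 ^ a
  ∎
  where
  regroup : ∀ x c p → x + 2 * c + 2 * p ≡ x + 2 * (c + p)
  regroup = solve-∀
  triple : ∀ x → x + 2 * x ≡ 3 * x
  triple = solve-∀

offset-block : ∀ a b → offset (block a b) ≡ 3 ^ a ∸ 2 ^ a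
offset-block a b = begin
    offset (block a b)                 ≡⟨ m+n∸n≡m (offset (block a b)) (2 ^ a) ⟨
    offset (block a b) + 2 ^ a ∸ 2 ^ a ≡⟨ cong (_∸ 2 ^ a) (offset-block+2^ a b) ⟩
    3 ^ a ∸ 2 ^ a                      ∎

range-extendʳ : ∀ {a b} → a ≤ suc b → range a (suc b) ≡ range a b ++ [ suc b ]
range-extendʳ {a} {b} a≤1+b = begin
    map (_+_ a) (upTo (suc (suc b) ∸ a))
  ≡⟨ cong (map (_+_ a) ∘ upTo) (+-∸-assoc 1 a≤1+b) ⟩
    map (_+_ a) (upTo (suc (suc b ∸ a)))
  ≡⟨ cong (map (_+_ a)) (upTo-∷ʳ (suc b ∸ a)) ⟨
    map (_+_ a) (upTo (suc b ∸ a) ++ [ suc b ∸ a ])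
  ≡⟨ map-++ (_+_ a) (upTo (suc b ∸ a)) [ suc b ∸ a ] ⟩
    range a b ++ [ a + (suc b ∸ a) ]
  ≡⟨ cong (λ i → range a b ++ [ i ]) (m+[n∸m]≡n a≤1+b) ⟩
    range a b ++ [ suc b ]
  ∎

Σ-extendʳ : ∀ f {a b} → a ≤ suc b → Σ[ f from a to suc b ] ≡ Σ[ f from a to b ] + f (suc b)
Σ-extendʳ f {a} {b} a≤1+b = begin
    sum (map f (range a (suc b)))
  ≡⟨ cong (sum ∘ map f) (range-extendʳ a≤1+b) ⟩
    sum (map f (range a b ++ [ suc b ]))
  ≡⟨ cong sum (map-++ f (range a b) [ suc b ]) ⟩
    sum (map f (range a b) ++ [ f (suc b) ])
  ≡⟨ sum-++ (map f (range a b)) [ f (suc b) ] ⟩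
    Σ[ f from a to b ] + (f (suc b) + 0)
  ≡⟨ cong (_+_ Σ[ f from a to b ]) (+-identityʳ (f (suc b))) ⟩
    Σ[ f from a to b ] + f (suc b)
  ∎

Σ-empty : ∀ f {a b} → b < a → Σ[ f from a to b ] ≡ 0
Σ-empty f {a} {b} b<a = cong (sum ∘ map f ∘ map (_+_ a) ∘ upTo) (m≤n⇒m∸n≡0 b<a)

Σ-*ʳ : ∀ f g c s → (∀ i → i ≤ s → f i ≡ g i * c) →
  Σ[ f from 1 to s ] ≡ Σ[ g from 1 to s ] * c
Σ-*ʳ f g c zero    f≡g*c = refl
Σ-*ʳ f g c (suc s) f≡g*c = begin
    Σ[ f from 1 to suc s ]
  ≡⟨ Σ-extendʳ f {b = s} (s≤s z≤n) ⟩
    Σ[ f from 1 to s ] + f (suc s)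
  ≡⟨ cong₂ _+_ (Σ-*ʳ f g c s (λ i i≤s → f≡g*c i (m≤n⇒m≤1+n i≤s)))
               (f≡g*c (suc s) ≤-refl) ⟩
    Σ[ g from 1 to s ] * c + g (suc s) * c
  ≡⟨ *-distribʳ-+ c (Σ[ g from 1 to s ]) (g (suc s)) ⟨
    (Σ[ g from 1 to s ] + g (suc s)) * c
  ≡⟨ cong (_* c) (Σ-extendʳ g {b = s} (s≤s z≤n)) ⟨
    Σ[ g from 1 to suc s ] * c
  ∎

module OrbSequence (u d : ℕ → ℕ) where

  orbTerm : ℕ → ℕ → ℕ
  orbTerm s i = 2 ^ Σ[ (λ j → u j + d j) from 1 to (i ∸ 1) ] * (3 ^ u i ∸ 2 ^ u i)
                * 3 ^ Σ[ u from (i + 1) to s ]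

  α : ℕ → ℕ
  α s = Σ[ orbTerm s from 1 to s ]

  orbWord-extendʳ : ∀ s → orbWord (suc s) u d ≡ orbWord s u d ++ block (u (suc s)) (d (suc s))
  orbWord-extendʳ s = begin
      concatMap orbBlock (range 1 (suc s))
    ≡⟨ cong (concatMap orbBlock) (range-extendʳ {b = s} (s≤s z≤n)) ⟩
      concatMap orbBlock (range 1 s ++ [ suc s ])
    ≡⟨ concatMap-++ orbBlock (range 1 s) [ suc s ] ⟩
      orbWord s u d ++ (orbBlock (suc s) ++ [])
    ≡⟨ cong (orbWord s u d ++_) (++-identityʳ (orbBlock (suc s))) ⟩
      orbWord s u d ++ orbBlock (suc s)
    ∎
    where
    orbBlock : ℕ → List Bool
    orbBlock i = block (u i) (d i)

  oddSteps-orbWord : ∀ s → oddSteps (orbWord s u d) ≡ Σ[ u from 1 to s ]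
  oddSteps-orbWord zero    = refl
  oddSteps-orbWord (suc s) = begin
      oddSteps (orbWord (suc s) u d)
    ≡⟨ cong oddSteps (orbWord-extendʳ s) ⟩
      oddSteps (orbWord s u d ++ block (u (suc s)) (d (suc s)))
    ≡⟨ oddSteps-++ (orbWord s u d) (block (u (suc s)) (d (suc s))) ⟩
      oddSteps (orbWord s u d) + oddSteps (block (u (suc s)) (d (suc s)))
    ≡⟨ cong₂ _+_ (oddSteps-orbWord s) (oddSteps-block (u (suc s)) (d (suc s))) ⟩
      Σ[ u from 1 to s ] + u (suc s)
    ≡⟨ Σ-extendʳ u {b = s} (s≤s z≤n) ⟨
      Σ[ u from 1 to suc s ]
    ∎

  length-orbWord : ∀ s → length (orbWord s u d) ≡ Σ[ (λ j → u j + d j) from 1 to s ]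
  length-orbWord zero    = refl
  length-orbWord (suc s) = begin
      length (orbWord (suc s) u d)
    ≡⟨ cong length (orbWord-extendʳ s) ⟩
      length (orbWord s u d ++ block (u (suc s)) (d (suc s)))
    ≡⟨ length-++ (orbWord s u d) ⟩
      length (orbWord s u d) + length (block (u (suc s)) (d (suc s)))
    ≡⟨ cong₂ _+_ (length-orbWord s) (length-block (u (suc s)) (d (suc s))) ⟩
      Σ[ (λ j → u j + d j) from 1 to s ] + (u (suc s) + d (suc s))
    ≡⟨ Σ-extendʳ (λ j → u j + d j) {b = s} (s≤s z≤n) ⟨
      Σ[ (λ j → u j + d j) from 1 to suc s ]
    ∎

  orbTerm-extendʳ : ∀ {s i} → i ≤ s → orbTerm (suc s) i ≡ orbTerm s i * 3 ^ u (suc s)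
  orbTerm-extendʳ {s} {i} i≤s = begin
      head * 3 ^ Σ[ u from (i + 1) to suc s ]
    ≡⟨ cong (λ e → head * 3 ^ e) (Σ-extendʳ u i+1≤1+s) ⟩
      head * 3 ^ (Σ[ u from (i + 1) to s ] + u (suc s))
    ≡⟨ cong (head *_) (^-distribˡ-+-* 3 (Σ[ u from (i + 1) to s ]) (u (suc s))) ⟩
      head * (3 ^ Σ[ u from (i + 1) to s ] * 3 ^ u (suc s))
    ≡⟨ *-assoc head _ _ ⟨
      orbTerm s i * 3 ^ u (suc s)
    ∎
    where
    head = 2 ^ Σ[ (λ j → u j + d j) from 1 to (i ∸ 1) ] * (3 ^ u i ∸ 2 ^ u i)
    i+1≤1+s : i + 1 ≤ suc s
    i+1≤1+s = subst (_≤ suc s) (+-comm 1 i) (s≤s i≤s)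

  α-extendʳ : ∀ s → α (suc s) ≡
    α s * 3 ^ u (suc s) + 2 ^ Σ[ (λ j → u j + d j) from 1 to s ] * (3 ^ u (suc s) ∸ 2 ^ u (suc s))
  α-extendʳ s = begin
      Σ[ orbTerm (suc s) from 1 to suc s ]
    ≡⟨ Σ-extendʳ (orbTerm (suc s)) {b = s} (s≤s z≤n) ⟩
      Σ[ orbTerm (suc s) from 1 to s ] + orbTerm (suc s) (suc s)
    ≡⟨ cong₂ _+_ (Σ-*ʳ (orbTerm (suc s)) (orbTerm s) (3 ^ u (suc s)) s (λ i → orbTerm-extendʳ))
                 (cong (λ e → last * 3 ^ e) (Σ-empty u (m<m+n (suc s) (s≤s z≤n)))) ⟩
      α s * 3 ^ u (suc s) + last * 1
    ≡⟨ cong (_+_ (α s * 3 ^ u (suc s))) (*-identityʳ last) ⟩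
      α s * 3 ^ u (suc s) + last
    ∎
    where
    last = 2 ^ Σ[ (λ j → u j + d j) from 1 to s ] * (3 ^ u (suc s) ∸ 2 ^ u (suc s))

  offset-orbWord : ∀ s → offset (orbWord s u d) ≡ α s
  offset-orbWord zero    = refl
  offset-orbWord (suc s) = begin
      offset (orbWord (suc s) u d)
    ≡⟨ cong offset (orbWord-extendʳ s) ⟩
      offset (W ++ B)
    ≡⟨ offset-++ W B ⟩
      offset W * 3 ^ oddSteps B + 2 ^ length W * offset B
    ≡⟨ cong₂ (λ c e → c * 3 ^ e + 2 ^ length W * offset B)
             (offset-orbWord s) (oddSteps-block (u (suc s)) (d (suc s))) ⟩
      α s * 3 ^ u (suc s) + 2 ^ length W * offset B
    ≡⟨ cong₂ (λ l c → α s * 3 ^ u (suc s) + 2 ^ l * c)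
             (length-orbWord s) (offset-block (u (suc s)) (d (suc s))) ⟩
      α s * 3 ^ u (suc s) + 2 ^ Σ[ (λ j → u j + d j) from 1 to s ] * (3 ^ u (suc s) ∸ 2 ^ u (suc s))
    ≡⟨ α-extendʳ s ⟨
      α (suc s)
    ∎
    where
    W = orbWord s u d
    B = block (u (suc s)) (d (suc s))

pos-^ : ∀ m n → (+ m) ℤ.^ n ≡ + (m ^ n)
pos-^ m zero    = refl
pos-^ m (suc n) = trans (cong ((+ m) ℤ.*_) (pos-^ m n)) (sym (ℤ.pos-* m (m ^ n)))

aT≡bT+e⇒T[a-b]≡e : ∀ {a b T e} → a * T ≡ b * T + e → + T ℤ.* (+ a - + b) ≡ + e
aT≡bT+e⇒T[a-b]≡e {a} {b} {T} {e} aT≡bT+e = begin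
    + T ℤ.* (+ a - + b)
  ≡⟨ distrib (+ T) (+ a) (+ b) ⟩
    + a ℤ.* + T - + b ℤ.* + T
  ≡⟨ cong₂ _-_ (ℤ.pos-* a T) (ℤ.pos-* b T) ⟨
    + (a * T) - + (b * T)
  ≡⟨ cong (λ x → + x - + (b * T)) aT≡bT+e ⟩
    + (b * T + e) - + (b * T)
  ≡⟨ cong (_- + (b * T)) (ℤ.pos-+ (b * T) e) ⟩
    + (b * T) ℤ.+ + e - + (b * T)
  ≡⟨ cancel (+ (b * T)) (+ e) ⟩
    + e
  ∎
  where
  distrib : ∀ (t x y : ℤ) → t ℤ.* (x - y) ≡ x ℤ.* t - y ℤ.* t
  distrib = ℤ-Solver.solve-∀
  cancel : ∀ (x y : ℤ) → x ℤ.+ y - x ≡ y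
  cancel = ℤ-Solver.solve-∀

-- Only the return F_k^(U+D)(T₀) = T₀ and the itinerary of T₀ are used: minimality, first
-- return and positivity just make the orb sequence canonical.
theorem5 : (k : ℕ) → 1 ≤ k → k % 2 ≡ 1 →
    (T₀ : ℕ) → 1 ≤ T₀ →
    (s : ℕ) → (u d : ℕ → ℕ) → 1 ≤ s →
    (∀ i → 1 ≤ i → i ≤ s → 1 ≤ u i) →
    (∀ i → 1 ≤ i → i ≤ s → 1 ≤ d i) →
    let U = Σ[ u from 1 to s ]
        D = Σ[ d from 1 to s ]
        β = (+ 2) ℤ.^ (U + D) - (+ 3) ℤ.^ U
        α = Σ[ (λ i → 2 ^ Σ[ (λ j → u j + d j) from 1 to (i ∸ 1) ]
                       Data.Nat.* (3 ^ u i ∸ 2 ^ u i)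
                       Data.Nat.* 3 ^ Σ[ u from (i + 1) to s ]) from 1 to s ]
    in
    iter k (U + D) T₀ ≡ T₀ →
    (∀ m → 0 < m → m < U + D → iter k m T₀ ≢ T₀) →
    (∀ m → T₀ ≤ iter k m T₀) →
    parityWord k (U + D) T₀ ≡ orbWord s u d →
    (+ T₀) ℤ.* β ≡ (+ k) ℤ.* (+ α)
theorem5 k _ k-odd T _ s u d _ _ _ returns _ _ itinerary = begin
    + T ℤ.* ((+ 2) ℤ.^ N - (+ 3) ℤ.^ U)
  ≡⟨ cong₂ (λ x y → + T ℤ.* (x - y)) (pos-^ 2 N) (pos-^ 3 U) ⟩
    + T ℤ.* (+ (2 ^ N) - + (3 ^ U))
  ≡⟨ aT≡bT+e⇒T[a-b]≡e {2 ^ N} {3 ^ U} {T} affine ⟩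
    + (k * α s)
  ≡⟨ ℤ.pos-* k (α s) ⟩
    + k ℤ.* + α s
  ∎
  where
  open OrbSequence u d using (α; oddSteps-orbWord; offset-orbWord)
  U = Σ[ u from 1 to s ]
  N = U + Σ[ d from 1 to s ]
  affine : 2 ^ N * T ≡ 3 ^ U * T + k * α s
  affine = begin
      2 ^ N * T
    ≡⟨ cong (2 ^ N *_) returns ⟨
      2 ^ N * iter k N T
    ≡⟨ iter-affine k-odd N T ⟩
      3 ^ oddSteps (parityWord k N T) * T + k * offset (parityWord k N T)
    ≡⟨ cong (λ w → 3 ^ oddSteps w * T + k * offset w) itinerary ⟩
      3 ^ oddSteps (orbWord s u d) * T + k * offset (orbWord s u d)
    ≡⟨ cong₂ (λ e c → 3 ^ e * T + k * c) (oddSteps-orbWord s) (offset-orbWord s) ⟩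
      3 ^ U * T + k * α s
    ∎
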